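{- For each $n\in\{3,4,5,6,7\}$, the graph $G_n$ is not strongly regular.
   Context: Let $P$ be the Petersen graph on vertex set $\{0,1,\dots,9\}$ whose 15 edges are the unordered pairs underlying the following set of directed edges (an orientation $\vec P$ of $P$): $E(\vec P)=\{(0,1),(0,4),(0,5),(1,2),(1,6),(2,3),(2,7),(3,4),(3,8),(4,9),(5,7),(5,8),(6,8),(6,9),(7,9)\}$. For $n\ge 3$ let $\sigma$ be the cyclic permutation of $\{1,\dots,n\}$ given by $\sigma(i)=i+1$ for $i<n$ and $\sigma(n)=1$. The graph $G_n$ is the simple undirected graph with vertex set $\{(i,x):1\le i\le n,\ 0\le x\le 9\}$ in which $(i,x)\sim(i,y)$ whenever $\{x,y\}$ is an edge of $P$, and $(i,x)\sim(\sigma(i),y)$ whenever $(x,y)\in E(\vec P)$. A graph is strongly regular with parameters $(v,k,\lambda,\mu)$ if it is $k$-regular on $v$ vertices, any two adjacent vertices have exactly $\lambda$ common neighbours, and any two distinct non-adjacent vertices have exactly $\mu$ common neighbours. -}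

module Defs where

open import Data.Nat using (ℕ; zero; suc; _+_; _*_)
open import Data.Fin using (Fin; zero; suc; toℕ; fromℕ; inject₁)
open import Data.Fin.Properties using (_≟_)
open import Data.Bool using (Bool; true; false; _∨_; _∧_; if_then_else_)
open import Data.Product using (_×_; _,_; proj₁; proj₂)
open import Data.List using (List; []; _∷_; cartesianProduct; filter; length)
open import Data.Bool.ListAction using (any)
open import Data.List using (allFin)
open import Relation.Nullary using (¬_; does)
open import Relation.Binary.PropositionalEquality using (_≡_)

-- The orientation of the Petersen graph, as a list of directed edges.
Pdir : List (Fin 10 × Fin 10)
Pdir = (# 0 , # 1) ∷ (# 0 , # 4) ∷ (# 0 , # 5) ∷ (# 1 , # 2) ∷ (# 1 , # 6)
     ∷ (# 2 , # 3) ∷ (# 2 , # 7) ∷ (# 3 , # 4) ∷ (# 3 , # 8) ∷ (# 4 , # 9)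
     ∷ (# 5 , # 7) ∷ (# 5 , # 8) ∷ (# 6 , # 8) ∷ (# 6 , # 9) ∷ (# 7 , # 9) ∷ []
  where open import Data.Fin using (#_)

arc : Fin 10 → Fin 10 → Bool
arc x y = any (λ e → does (proj₁ e ≟ x) ∧ does (proj₂ e ≟ y)) Pdir

pedge : Fin 10 → Fin 10 → Bool
pedge x y = arc x y ∨ arc y x

-- the cyclic permutation σ of {1,…,n}, with i ∈ {1,…,n} represented by
-- Fin n (index i-1): σ sends k ↦ k+1 for k < n-1 and n-1 ↦ 0.
σ : {n : ℕ} → Fin n → Fin n
σ {suc m} i with m Data.Nat.≟ toℕ i
... | Relation.Nullary.yes _ = zero
... | Relation.Nullary.no ¬p = suc (Data.Fin.lower₁ i ¬p)

V : ℕ → Set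
V n = Fin n × Fin 10

adj : (n : ℕ) → V n → V n → Bool
adj n (i , x) (j , y) =
  (does (i ≟ j) ∧ pedge x y)
  ∨ (does (σ i ≟ j) ∧ arc x y)
  ∨ (does (σ j ≟ i) ∧ arc y x)

vertices : (n : ℕ) → List (V n)
vertices n = cartesianProduct (allFin n) (allFin 10)

common : (n : ℕ) → V n → V n → ℕ
common n u w = length (filter (λ z → Data.Bool._≟_ (adj n u z ∧ adj n w z) true) (vertices n))

degree : (n : ℕ) → V n → ℕ
degree n u = length (filter (λ z → Data.Bool._≟_ (adj n u z) true) (vertices n))

IsSRG : (n : ℕ) → ℕ → ℕ → ℕ → ℕ → Set
IsSRG n v k l m =
  (length (vertices n) ≡ v)
  × (∀ u → degree n u ≡ k)
  × (∀ u w → ¬ (u ≡ w) → adj n u w ≡ true → common n u w ≡ l)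
  × (∀ u w → ¬ (u ≡ w) → adj n u w ≡ false → common n u w ≡ m)

StronglyRegular : ℕ → Set
StronglyRegular n = Data.Product.Σ ℕ λ v → Data.Product.Σ ℕ λ k →
  Data.Product.Σ ℕ λ l → Data.Product.Σ ℕ λ m → IsSRG n v k l m

{-# OPTIONS --safe #-}
module Submission where

open import Defs
open import Data.Nat using (ℕ; _≤_; suc; s≤s)
open import Data.Product using (_,_)
open import Data.Fin using (Fin; zero; #_)
open import Data.Bool using (false)
open import Relation.Nullary using (¬_)
open import Relation.Binary.PropositionalEquality using (_≡_; _≢_; refl; trans; sym)

-- In a layer of G_n the vertices 0 and 2 keep the unique common neighbour 1 they have in
-- the Petersen graph, whereas 0 and 3 acquire a second one: both are tails of the arcs
-- into 4, so besides (i , 4) they share (σ i , 4).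

common-nonadjacent-unique : ∀ {n v k l μ} → IsSRG n v k l μ → ∀ {u w u′ w′ : V n} →
  u ≢ w → adj n u w ≡ false → u′ ≢ w′ → adj n u′ w′ ≡ false →
  common n u w ≡ common n u′ w′
common-nonadjacent-unique (_ , _ , _ , nonadjacent) u≢w uw u′≢w′ u′w′ =
  trans (nonadjacent _ _ u≢w uw) (sym (nonadjacent _ _ u′≢w′ u′w′))

¬StronglyRegular-if-common-nonadjacent-differs : ∀ {n} (u w u′ w′ : V n) →
  u ≢ w → adj n u w ≡ false → u′ ≢ w′ → adj n u′ w′ ≡ false →
  common n u w ≢ common n u′ w′ → ¬ StronglyRegular n
¬StronglyRegular-if-common-nonadjacent-differs u w u′ w′ u≢w uw u′≢w′ u′w′ differs
  (_ , _ , _ , _ , srg) =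
  differs (common-nonadjacent-unique srg u≢w uw u′≢w′ u′w′)

layer₀ : ∀ {m} → Fin 10 → V (suc m)
layer₀ x = zero , x

¬StronglyRegular-G : (m : ℕ) →
  adj (suc m) (layer₀ (# 0)) (layer₀ (# 2)) ≡ false →
  adj (suc m) (layer₀ (# 0)) (layer₀ (# 3)) ≡ false →
  common (suc m) (layer₀ (# 0)) (layer₀ (# 2)) ≡ 1 →
  common (suc m) (layer₀ (# 0)) (layer₀ (# 3)) ≡ 2 →
  ¬ StronglyRegular (suc m)
¬StronglyRegular-G m nonadj₀₂ nonadj₀₃ common₀₂ common₀₃ =
  ¬StronglyRegular-if-common-nonadjacent-differs
    (layer₀ (# 0)) (layer₀ (# 2)) (layer₀ (# 0)) (layer₀ (# 3))
    (λ ()) nonadj₀₂ (λ ()) nonadj₀₃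
    (λ same → 1≢2 (trans (sym common₀₂) (trans same common₀₃)))
  where
  1≢2 : 1 ≢ 2
  1≢2 ()

proposition7p3 : (n : ℕ) → 3 ≤ n → n ≤ 7 → ¬ StronglyRegular n
proposition7p3 3 _ _ = ¬StronglyRegular-G 2 refl refl refl refl
proposition7p3 4 _ _ = ¬StronglyRegular-G 3 refl refl refl refl
proposition7p3 5 _ _ = ¬StronglyRegular-G 4 refl refl refl refl
proposition7p3 6 _ _ = ¬StronglyRegular-G 5 refl refl refl refl
proposition7p3 7 _ _ = ¬StronglyRegular-G 6 refl refl refl refl
proposition7p3 0 () _
proposition7p3 1 (s≤s ()) _
proposition7p3 2 (s≤s (s≤s ())) _
proposition7p3 (suc (suc (suc (suc (suc (suc (suc (suc _)))))))) _
  (s≤s (s≤s (s≤s (s≤s (s≤s (s≤s (s≤s ())))))))
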